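{- Let $G$ be a weighted game arena with partial observation, $\ell_{\max}\in\mathbb{N}_0$, $\rho=o_0\sigma_0\dots o_n$ a finite abstract path, $\phi\in\mathcal{F}$ with $\mathrm{supp}(\phi)\subseteq o_0$, and $\mathrm{supp}^{ -1}(\rho,\phi)=f_0\sigma_0\dots f_n$. Then a state $q\in Q$ is the last state $q_n=q$ of some concrete path $q_0\sigma_0\dots q_n\in\gamma(\rho)$ with $q_0\in\mathrm{supp}(\phi)$ if and only if $q\in\mathrm{supp}(f_n)$.
   Context: A WGA is $G=\langle Q,q_I,\Sigma,\Delta,w,Obs\rangle$: $Q$ finite set of states, $q_I\in Q$, $\Sigma$ finite set of actions, $\Delta\subseteq Q\times\Sigma\times Q$ total transition relation, $w:\Delta\to\mathbb{Z}$, $Obs$ a partition of $Q$ with $\{q_I\}\in Obs$; $W=\max\{|w(t)|:t\in\Delta\}$; $\mathrm{post}_\sigma(s)=\{q':\exists q\in s,(q,\sigma,q')\in\Delta\}$. A finite abstract path $o_0\sigma_0\dots o_n$ ($o_i\in Obs$) is one for which some concrete path $q_0\sigma_0\dots q_n$ (with $(q_i,\sigma_i,q_{i+1})\in\Delta$) has $q_i\in o_i$ for all $i$; $\gamma(\rho)$ is the set of all such concrete paths. $\mathbb{N}_0=\{1,2,\dots\}$. Fix $\ell_{\max}\in\mathbb{N}_0$. $\mathcal{F}$ is the set of all functions $f:Q\to(\{1,\dots,\ell_{\max}\}\to\{ -W\ell_{\max},\dots,0\})\cup\{\bot\}$; $\mathrm{supp}(f)=\{q:f(q)\ne\bot\}$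 and $f(q)_i=f(q)(i)$. For $f_1,f_2\in\mathcal{F}$ and $\sigma\in\Sigma$, $f_2$ is a $\sigma$-successor of $f_1$ if $\mathrm{supp}(f_2)=\mathrm{post}_\sigma(\mathrm{supp}(f_1))\cap o$ for some $o\in Obs$, and for all $q\in\mathrm{supp}(f_2)$ and $1\le j\le\ell_{\max}$, $f_2(q)_j=\max\{ -W\ell_{\max},\min\{0,\zeta_j(q)\}\}$, where $\zeta_1(q)=\min\{w(p,\sigma,q):p\in\mathrm{supp}(f_1),(p,\sigma,q)\in\Delta\}$ and, for $j\ge2$, $\zeta_j(q)=\min\{f_1(p)_{j-1}+w(p,\sigma,q):p\in\mathrm{supp}(f_1),(p,\sigma,q)\in\Delta,f_1(p)_{j-1}<0\}$ (the minimum of the empty set being $+\infty$). For a finite abstract path $\rho=o_0\sigma_0\dots o_n$ and $\phi\in\mathcal{F}$ with $\mathrm{supp}(\phi)\subseteq o_0$, $\mathrm{supp}^{ -1}(\rho,\phi)=f_0\sigma_0f_1\dots f_n$ where $f_0=\phi$ and $f_{i+1}$ is the $\sigma_i$-successor of $f_i$ with $\mathrm{supp}(f_{i+1})=\mathrm{post}_{\sigma_i}(\mathrm{supp}(f_i))\cap o_{i+1}$. -}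

module Defs where

open import Data.Nat as ℕ using (ℕ; zero; suc; _⊔_)
open import Data.Integer as ℤ using (ℤ; +_; -_; ∣_∣; _<_; _≤_)
open import Data.Fin using (Fin; zero; suc; inject₁; fromℕ)
open import Data.List using (List; []; _∷_; [_]; foldr; concatMap)
open import Data.List.Base using (allFin)
open import Data.Maybe using (Maybe; just; nothing; maybe; is-just)
open import Data.Bool using (Bool; true; false; if_then_else_)
open import Data.Product using (Σ; ∃; _×_; _,_)
open import Relation.Binary.PropositionalEquality using (_≡_)
open import Relation.Nullary using (Dec; yes; no)
open import Function.Bundles using (_⇔_)

-- States Q = Fin nQ, actions Σ = Fin nΣ, observations = Fin nO.
-- The partition Obs is given by the labelling obs : Q → Fin nO
-- (block o = {q | obs q ≡ o}); surjectivity makes every block nonempty.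
-- Δ is given as a Boolean-valued relation; w is the weight of each
-- transition (its values on non-transitions are irrelevant).
record WGA : Set where
  field
    nQ nΣ nO     : ℕ
    qI           : Fin nQ
    Δ            : Fin nQ → Fin nΣ → Fin nQ → Bool
    w            : Fin nQ → Fin nΣ → Fin nQ → ℤ
    obs          : Fin nQ → Fin nO
    total        : ∀ q σ → ∃ λ q' → Δ q σ q' ≡ true
    obs-surj     : ∀ o → ∃ λ q → obs q ≡ o
    qI-singleton : ∀ q → obs q ≡ obs qI → q ≡ qI

module _ (G : WGA) where
  open WGA G

  Wmax : ℕ
  Wmax = foldr _⊔_ 0
    (concatMap (λ q → concatMap (λ σ → concatMap (λ q' →
       if Δ q σ q' then [ ∣ w q σ q' ∣ ] else [])
       (allFin nQ)) (allFin nΣ)) (allFin nQ))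

  post : Fin nΣ → (Fin nQ → Set) → Fin nQ → Set
  post σ s q' = ∃ λ q → s q × (Δ q σ q' ≡ true)

  -- Finite abstract paths o_0 σ_0 ... o_n: os : Fin (suc n) → Obs, σs : Fin n → Σ.
  -- A concrete path q_0 σ_0 ... q_n follows the actions σs.
  IsConcretePath : (n : ℕ) → (Fin n → Fin nΣ) → (Fin (suc n) → Fin nQ) → Set
  IsConcretePath n σs qs = ∀ (i : Fin n) → Δ (qs (inject₁ i)) (σs i) (qs (suc i)) ≡ true

  InGamma : (n : ℕ) → (Fin (suc n) → Fin nO) → (Fin n → Fin nΣ) → (Fin (suc n) → Fin nQ) → Set
  InGamma n os σs qs = IsConcretePath n σs qs × (∀ i → obs (qs i) ≡ os i)

  IsAbstractPath : (n : ℕ) → (Fin (suc n) → Fin nO) → (Fin n → Fin nΣ) → Set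
  IsAbstractPath n os σs = ∃ λ qs → InGamma n os σs qs

  -- ℓmax = suc L ∈ ℕ₀; index i ∈ {1..ℓmax} is represented by Fin (suc L) (i ↦ i-1).
  module _ (L : ℕ) where
    ℓmax : ℕ
    ℓmax = suc L

    lowBound : ℤ
    lowBound = - (+ (Wmax ℕ.* ℓmax))

    Fun : Set
    Fun = Fin nQ → Maybe (Fin ℓmax → ℤ)

    InF : Fun → Set
    InF f = ∀ q v → f q ≡ just v → ∀ i → (lowBound ≤ v i) × (v i ≤ + 0)

    supp : Fun → Fin nQ → Set
    supp f q = is-just (f q) ≡ true

    -- minimum of a finite list of integers; nothing represents +∞ (min ∅)
    minList : List ℤ → Maybe ℤ
    minList = foldr (λ x acc → just (maybe (ℤ._⊓ x) x acc)) nothing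

    clamp : Maybe ℤ → ℤ
    clamp z = lowBound ℤ.⊔ maybe (ℤ._⊓_ (+ 0)) (+ 0) z

    ζ : Fun → Fin nΣ → Fin ℓmax → Fin nQ → Maybe ℤ
    ζ f1 σ zero q = minList (concatMap (λ p → case-p (f1 p) p) (allFin nQ))
      where
        case-p : Maybe (Fin ℓmax → ℤ) → Fin nQ → List ℤ
        case-p nothing  p = []
        case-p (just v) p = if Δ p σ q then [ w p σ q ] else []
    ζ f1 σ (suc j) q = minList (concatMap (λ p → case-p (f1 p) p) (allFin nQ))
      where
        case-p : Maybe (Fin ℓmax → ℤ) → Fin nQ → List ℤ
        case-p nothing  p = []
        case-p (just v) p with Δ p σ q | v (inject₁ j) ℤ.<? + 0
        ... | true | yes _ = [ v (inject₁ j) ℤ.+ w p σ q ]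
        ... | _    | _     = []

    SuccVia : Fin nO → Fin nΣ → Fun → Fun → Set
    SuccVia o σ f1 f2 =
      InF f2 ×
      (∀ q → supp f2 q ⇔ (post σ (supp f1) q × (obs q ≡ o))) ×
      (∀ q v → f2 q ≡ just v → ∀ j → v j ≡ clamp (ζ f1 σ j q))

    IsSucc : Fin nΣ → Fun → Fun → Set
    IsSucc σ f1 f2 = ∃ λ o → SuccVia o σ f1 f2

    seqF : {n : ℕ} → Fun → (Fin n → Fun) → Fin (suc n) → Fun
    seqF φ fs zero    = φ
    seqF φ fs (suc i) = fs i

    IsSuppInv : (n : ℕ) → (Fin (suc n) → Fin nO) → (Fin n → Fin nΣ) → Fun → (Fin n → Fun) → Set
    IsSuppInv n os σs φ fs = ∀ (i : Fin n) →
      SuccVia (os (suc i)) (σs i) (seqF φ fs (inject₁ i)) (seqF φ fs (suc i))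

-- Only the supports of the f_i matter: supp(f_{i+1}) is exactly the set of
-- σ_i-successors of supp(f_i) lying in o_{i+1}. So supp(f_i) is the set of states
-- reachable in i steps along ρ from supp(φ), which follows by induction on the
-- length of ρ, peeling off its first step.
module Submission where

open import Defs
open import Data.Nat using (ℕ; suc; zero)
open import Data.Fin using (Fin; zero; suc; fromℕ; inject₁)
open import Data.Bool using (true)
open import Data.Vec.Functional using (_∷_; tail)
open import Data.Product using (∃; _×_; _,_; proj₁; proj₂)
open import Relation.Binary.PropositionalEquality using (_≡_; refl)
open import Function.Bundles using (_⇔_; mk⇔; Equivalence)
open WGA

module _ (G : WGA) where

  InGamma-tail : ∀ {n os σs qs} → InGamma G (suc n) os σs qs →
                 InGamma G n (tail os) (tail σs) (tail qs)
  InGamma-tail (step , inObs) = (λ i → step (suc i)) , (λ i → inObs (suc i))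

  InGamma-∷ : ∀ {n os σs qs p} → InGamma G n (tail os) (tail σs) qs →
              Δ G p (σs zero) (qs zero) ≡ true → obs G p ≡ os zero →
              InGamma G (suc n) os σs (p ∷ qs)
  InGamma-∷ (step , inObs) firstStep pInObs =
    (λ { zero → firstStep ; (suc i) → step i }) ,
    (λ { zero → pInObs ; (suc i) → inObs i })

  IsReachTrace : (n : ℕ) → (Fin (suc n) → Fin (nO G)) → (Fin n → Fin (nΣ G)) →
                 (Fin (suc n) → Fin (nQ G) → Set) → Set
  IsReachTrace n os σs S = ∀ i q →
    S (suc i) q ⇔ (post G (σs i) (S (inject₁ i)) q × obs G q ≡ os (suc i))

  EndsInGammaFrom : (n : ℕ) → (Fin (suc n) → Fin (nO G)) → (Fin n → Fin (nΣ G)) →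
                    (Fin (nQ G) → Set) → Fin (nQ G) → Set
  EndsInGammaFrom n os σs S₀ q =
    ∃ λ qs → InGamma G n os σs qs × (qs (fromℕ n) ≡ q) × S₀ (qs zero)

  endsInGammaFrom⇔last : ∀ n os σs (S : Fin (suc n) → Fin (nQ G) → Set) →
    IsReachTrace n os σs S → (∀ q → S zero q → obs G q ≡ os zero) →
    ∀ q → EndsInGammaFrom n os σs (S zero) q ⇔ S (fromℕ n) q
  endsInGammaFrom⇔last zero os σs S trace S₀⊆o₀ q = mk⇔ to from
    where
    to : EndsInGammaFrom zero os σs (S zero) q → S zero q
    to (qs , _ , refl , start) = start

    from : S zero q → EndsInGammaFrom zero os σs (S zero) q
    from start = (λ _ → q) , ((λ ()) , λ { zero → S₀⊆o₀ q start }) , refl , start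
  endsInGammaFrom⇔last (suc n) os σs S trace S₀⊆o₀ q = mk⇔ to from
    where
    firstStep : ∀ q → S (suc zero) q ⇔ (post G (σs zero) (S zero) q × obs G q ≡ os (suc zero))
    firstStep = trace zero

    fromSecond : EndsInGammaFrom n (tail os) (tail σs) (S (suc zero)) q ⇔ S (fromℕ (suc n)) q
    fromSecond = endsInGammaFrom⇔last n (tail os) (tail σs) (λ i → S (suc i))
      (λ i → trace (suc i)) (λ q s → proj₂ (Equivalence.to (firstStep q) s)) q

    to : EndsInGammaFrom (suc n) os σs (S zero) q → S (fromℕ (suc n)) q
    to (qs , path@(step , inObs) , end , start) =
      Equivalence.to fromSecond
        ( tail qs , InGamma-tail path , end
        , Equivalence.from (firstStep (qs (suc zero))) ((qs zero , start , step zero) , inObs (suc zero)))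

    from : S (fromℕ (suc n)) q → EndsInGammaFrom (suc n) os σs (S zero) q
    from last with Equivalence.from fromSecond last
    ... | qs , path , end , second with Equivalence.to (firstStep (qs zero)) second
    ... | (p , start , edge) , _ = p ∷ qs , InGamma-∷ path edge (S₀⊆o₀ p start) , end , start

lemma3 : (G : WGA) (L : ℕ) (n : ℕ)
    (os : Fin (suc n) → Fin (nO G)) (σs : Fin n → Fin (nΣ G))
    → IsAbstractPath G n os σs
    → (φ : Fun G L) → InF G L φ
    → (∀ q → supp G L φ q → obs G q ≡ os zero)
    → (fs : Fin n → Fun G L) → IsSuppInv G L n os σs φ fs
    → ∀ (q : Fin (nQ G)) →
    (∃ λ qs → InGamma G n os σs qs × (qs (fromℕ n) ≡ q) × supp G L φ (qs zero))
    ⇔ supp G L (seqF G L φ fs (fromℕ n)) q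
lemma3 G L n os σs _ φ _ φ⊆o₀ fs suppInv =
  endsInGammaFrom⇔last G n os σs (λ i → supp G L (seqF G L φ fs i))
    (λ i → proj₁ (proj₂ (suppInv i))) φ⊆o₀
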